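{- Let $r\geq 1$ be an integer and $k\in\mathbb{Z}$. For every integer $n\geq 0$, \[ \tilde{A}_{n}^{(r,k)}(x)=\sum_{j=0}^{n}\left\{\sum_{l=0}^{n-j}\sum_{a=0}^{n-j-l}\sum_{a_{1}+\cdots+a_{r}=a}\binom{n}{l+j}\binom{n-j-l}{a}\binom{a}{a_{1},\ldots,a_{r}}S_{1}(l+j,j)\left(\prod_{i=1}^{r}B_{a_{i}}^{(a_{i})}\right)\tilde{C}_{n-j-l-a}^{(k)}\right\}x^{j}, \] where the inner sum runs over all $r$-tuples of nonnegative integers $(a_1,\ldots,a_r)$ with $a_1+\cdots+a_r=a$.
   Context: For $k\in\mathbb{Z}$ let $\mathrm{Lif}_{k}(x)=\sum_{m=0}^{\infty}\frac{x^{m}}{m!(m+1)^{k}}$. For an integer $r\geq 0$ and $k\in\mathbb{Z}$, the polynomials $\tilde{A}_{n}^{(r,k)}(x)$ are defined by \[ \left(\frac{t}{(1+t)\log(1+t)}\right)^{r}\mathrm{Lif}_{k}\bigl(-\log(1+t)\bigr)(1+t)^{x}=\sum_{n=0}^{\infty}\tilde{A}_{n}^{(r,k)}(x)\frac{t^{n}}{n!}. \] The poly-Cauchy numbers of the second kind $\tilde{C}_{n}^{(k)}$ are defined by $\mathrm{Lif}_{k}(-\log(1+t))=\sum_{n\geq 0}\tilde{C}_{n}^{(k)}\frac{t^{n}}{n!}$. For $\alpha\in\mathbb{Z}$, Bernoulli polynomials of order $\alpha$ are defined by $\left(\frac{t}{e^{t}-1}\right)^{\alpha}e^{xt}=\sum_{n\geq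 0}B_{n}^{(\alpha)}(x)\frac{t^{n}}{n!}$, and $B_{n}^{(\alpha)}=B_{n}^{(\alpha)}(0)$. $\binom{a}{a_1,\ldots,a_r}$ is the multinomial coefficient. $S_{1}(n,m)$ are the Stirling numbers of the first kind, defined by $x(x-1)\cdots(x-n+1)=\sum_{m=0}^{n}S_{1}(n,m)x^{m}$. -}

module Defs where

open import Data.Nat as ℕ using (ℕ; zero; suc; _!; _∸_)
open import Data.Integer as ℤ using (ℤ; +_; -[1+_])
open import Data.Rational using (ℚ; 0ℚ; 1ℚ; _+_; _*_; -_; _-_; _/_)
open import Data.List using (List; []; _∷_; foldr; zipWith; applyUpTo)
open import Data.Nat.Combinatorics using (_C_)
open import Data.Vec using (Vec; []; _∷_)

ℤtoℚ : ℤ → ℚ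
ℤtoℚ z = z / 1

ℕtoℚ : ℕ → ℚ
ℕtoℚ n = ℤtoℚ (+ n)

-- reciprocal 1/n of a natural number (only ever applied to n ≥ 1; 1/0 := 0)
recip : ℕ → ℚ
recip zero    = 0ℚ
recip (suc n) = + 1 / suc n

sumTo : ℕ → (ℕ → ℚ) → ℚ
sumTo zero    f = f 0
sumTo (suc n) f = sumTo n f + f (suc n)

sgn : ℕ → ℚ
sgn zero    = 1ℚ
sgn (suc n) = - sgn n

powQ : ℚ → ℕ → ℚ
powQ q zero    = 1ℚ
powQ q (suc n) = q * powQ q n

-- Formal power series over ℚ, given by their coefficient sequences

PS : Set
PS = ℕ → ℚ

_⊛_ : PS → PS → PS
(f ⊛ g) n = sumTo n (λ i → f i * g (n ∸ i))

psPow : PS → ℕ → PS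
psPow f zero    = λ n → Data.Rational._/_ (+ (if0 n)) 1
  where
  if0 : ℕ → ℕ
  if0 zero    = 1
  if0 (suc _) = 0
psPow f (suc m) = f ⊛ psPow f m

-- multiplicative inverse of a power series f with f 0 = 1:
-- g 0 = 1, g (n+1) = - Σ_{i=1}^{n+1} f i · g (n+1-i).
-- invUpTo f n = [g n, g (n-1), …, g 0]
invUpTo : PS → ℕ → List ℚ
invUpTo f zero    = 1ℚ ∷ []
invUpTo f (suc n) =
  let gs = invUpTo f n in
  (- foldr _+_ 0ℚ (zipWith _*_ (applyUpTo (λ i → f (suc i)) (suc n)) gs)) ∷ gs

psInv : PS → PS
psInv f n with invUpTo f n
... | g ∷ _ = g
... | []    = 0ℚ

-- log(1+t) = Σ_{n≥1} (-1)^{n+1} t^n / n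
logOnePlus : PS
logOnePlus zero    = 0ℚ
logOnePlus (suc n) = sgn n * recip (suc n)

-- (1+t) log(1+t) / t ; coefficient of t^n is [t^{n+1}] ((1+t) log(1+t))
onePlusTimesLogOverT : PS
onePlusTimesLogOverT n = logOnePlus (suc n) + logOnePlus n

tOverOnePlusLog : PS
tOverOnePlusLog = psInv onePlusTimesLogOverT

-- (1+t)^x = Σ_n x(x-1)…(x-n+1) t^n / n!
fallingQ : ℚ → ℕ → ℚ
fallingQ x zero    = 1ℚ
fallingQ x (suc n) = fallingQ x n * (x - ℕtoℚ n)

onePlusPow : ℚ → PS
onePlusPow x n = fallingQ x n * recip (n !)

invPowInt : ℕ → ℤ → ℚ
invPowInt m (+ k)      = recip (suc m ℕ.^ k)
invPowInt m -[1+ k ]   = ℕtoℚ (suc m ℕ.^ suc k)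

-- coefficient 1/(m! (m+1)^k) of x^m in Lif_k(x)
lifCoeff : ℤ → ℕ → ℚ
lifCoeff k m = recip (m !) * invPowInt m k

-- Lif_k(-log(1+t)) = Σ_m lifCoeff k m · (-log(1+t))^m ;
-- since (-log(1+t))^m has order m, only m ≤ n contribute to t^n
lifNegLog : ℤ → PS
lifNegLog k n = sumTo n (λ m → lifCoeff k m * psPow (λ i → - logOnePlus i) m n)

Atilde : ℕ → ℤ → ℕ → ℚ → ℚ
Atilde r k n x =
  ℕtoℚ (n !) * ((psPow tOverOnePlusLog r ⊛ lifNegLog k) ⊛ onePlusPow x) n

Ctilde : ℤ → ℕ → ℚ
Ctilde k n = ℕtoℚ (n !) * lifNegLog k n

-- (e^t - 1)/t = Σ_n t^n/(n+1)!
expMinusOneOverT : PS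
expMinusOneOverT n = recip (suc n !)

tOverExpMinusOne : PS
tOverExpMinusOne = psInv expMinusOneOverT

bernoulliOrd : ℕ → ℕ → ℚ
bernoulliOrd α n = ℕtoℚ (n !) * psPow tOverExpMinusOne α n

-- Stirling numbers of the first kind (signed):
-- x(x-1)…(x-n+1) = Σ_m S₁(n,m) x^m
stirling1 : ℕ → ℕ → ℤ
stirling1 zero    zero    = + 1
stirling1 zero    (suc m) = + 0
stirling1 (suc n) zero    = + 0
stirling1 (suc n) (suc m) = stirling1 n m ℤ.- (+ n) ℤ.* stirling1 n (suc m)

binomQ : ℕ → ℕ → ℚ
binomQ n k = ℕtoℚ (n C k)

vsum : ∀ {r} → Vec ℕ r → ℕ
vsum []       = 0
vsum (a ∷ as) = a ℕ.+ vsum as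

vprodQ : ∀ {r} → (ℕ → ℚ) → Vec ℕ r → ℚ
vprodQ f []       = 1ℚ
vprodQ f (a ∷ as) = f a * vprodQ f as

multinomial : ∀ {r} → ℕ → Vec ℕ r → ℚ
multinomial a as = ℕtoℚ (a !) * vprodQ (λ b → recip (b !)) as

sumComp : (r a : ℕ) → (Vec ℕ r → ℚ) → ℚ
sumComp zero    zero    f = f []
sumComp zero    (suc a) f = 0ℚ
sumComp (suc r) a       f = sumTo a (λ b → sumComp r (a ∸ b) (λ v → f (b ∷ v)))

coeffRHS : ℕ → ℤ → ℕ → ℕ → ℚ
coeffRHS r k n j =
  sumTo (n ∸ j) λ l →
  sumTo (n ∸ j ∸ l) λ a →
  sumComp r a λ as →
    binomQ n (l ℕ.+ j) * binomQ (n ∸ j ∸ l) a * multinomial a as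
    * ℤtoℚ (stirling1 (l ℕ.+ j) j)
    * vprodQ (λ b → bernoulliOrd b b) as
    * Ctilde k (n ∸ j ∸ l ∸ a)

rhs : ℕ → ℤ → ℕ → ℚ → ℚ
rhs r k n x = sumTo n (λ j → coeffRHS r k n j * powQ x j)

module Submission where

-- The heart of the proof is the classical identity
--     T := t / ((1+t) log(1+t)) = Σ_m B_m^{(m)} t^m / m!,  i.e. [t^m] T = [t^m] φ^m
-- for φ = t/(e^t - 1). With ψ = e^t - 1 = t/φ and G = 1/T = (1+t)log(1+t)/t one has
-- Σ_i G_i [t^{n-i}] φ^{n-i} = [t^n] G(ψ) φ^n, and G(ψ) ψ = t e^t because
-- log(1+ψ) = t (via a chain rule for composition). So the sum is [t^n] e^t φ^{n+1},
-- which is δ_{n0} by the differential equation e^t φ² + t φ' = φ; hence the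
-- diagonal sequence is the inverse of G, i.e. T.

open import Defs
open import Data.Nat as ℕ using (ℕ; zero; suc; _≤_; _<_; _≥_; z≤n; s≤s; _∸_; _!)
import Data.Nat.Properties as ℕP
open import Data.Nat.Combinatorics using (_C_; nCk≡n!/k![n-k]!; [n∸k]!k!∣n!)
open import Data.Nat.DivMod using (m/n*n≡m)
open import Data.Nat.Divisibility using (_∣_)
import Data.Nat.Coprimality as Coprime
open import Data.Integer as ℤ using (ℤ)
import Data.Integer.Properties as ℤP
open import Data.Rational using (ℚ; 0ℚ; 1ℚ; _+_; _*_; -_; _-_; _/_; mkℚ)
import Data.Rational.Properties as ℚP
open import Data.List using (foldr; zipWith; applyUpTo)
open import Data.Vec using (Vec; []; _∷_)
open import Data.Maybe.Base using (Maybe; just; nothing)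
open import Data.Product using (_,_)
open import Level using (0ℓ)
open import Relation.Nullary using (yes; no)
open import Relation.Binary.PropositionalEquality
open import Algebra.Bundles using (CommutativeRing)
import Relation.Binary.Reasoning.Setoid as SetoidReasoning
import Algebra.Solver.Ring.NaturalCoefficients as NatCoeffSolver
open import Tactic.RingSolver using (solve-∀)
import Tactic.RingSolver.Core.AlmostCommutativeRing as ACR

ℚ-ring : ACR.AlmostCommutativeRing 0ℓ 0ℓ
ℚ-ring = ACR.fromCommutativeRing ℚP.+-*-commutativeRing isZero
  where
  isZero : (x : ℚ) → Maybe (0ℚ ≡ x)
  isZero x with 0ℚ ℚP.≟ x
  ... | yes p = just p
  ... | no _  = nothing

-- ℤtoℚ z = z/1 is already in normal form; this makes it a ring homomorphism.
ℤtoℚ-normal : ∀ z → ℤtoℚ z ≡ mkℚ z 0 (Coprime.sym (Coprime.1-coprimeTo _))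
ℤtoℚ-normal z = ℚP.↥p/↧p≡p (mkℚ z 0 (Coprime.sym (Coprime.1-coprimeTo _)))

ℤtoℚ-+ : ∀ a b → ℤtoℚ (a ℤ.+ b) ≡ ℤtoℚ a + ℤtoℚ b
ℤtoℚ-+ a b rewrite ℤtoℚ-normal a | ℤtoℚ-normal b =
  cong (_/ 1) (cong₂ ℤ._+_ (sym (ℤP.*-identityʳ a)) (sym (ℤP.*-identityʳ b)))

ℤtoℚ-* : ∀ a b → ℤtoℚ (a ℤ.* b) ≡ ℤtoℚ a * ℤtoℚ b
ℤtoℚ-* a b rewrite ℤtoℚ-normal a | ℤtoℚ-normal b = refl

ℤtoℚ-neg : ∀ a → ℤtoℚ (ℤ.- a) ≡ - ℤtoℚ a
ℤtoℚ-neg a = begin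
  ℤtoℚ (ℤ.- a)                   ≡⟨ add-sub (ℤtoℚ (ℤ.- a)) (ℤtoℚ a) ⟩
  (ℤtoℚ (ℤ.- a) + ℤtoℚ a) - ℤtoℚ a ≡⟨ cong (_- ℤtoℚ a) (sym (ℤtoℚ-+ (ℤ.- a) a)) ⟩
  ℤtoℚ (ℤ.- a ℤ.+ a) - ℤtoℚ a      ≡⟨ cong (λ z → ℤtoℚ z - ℤtoℚ a) (ℤP.+-inverseˡ a) ⟩
  0ℚ - ℤtoℚ a                      ≡⟨ ℚP.+-identityˡ _ ⟩
  - ℤtoℚ a                         ∎
  where
  open ≡-Reasoning
  add-sub : ∀ x y → x ≡ (x + y) - y
  add-sub = solve-∀ ℚ-ring

ℤtoℚ-− : ∀ a b → ℤtoℚ (a ℤ.- b) ≡ ℤtoℚ a - ℤtoℚ b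
ℤtoℚ-− a b = trans (ℤtoℚ-+ a (ℤ.- b)) (cong (ℤtoℚ a +_) (ℤtoℚ-neg b))

ℕtoℚ-+ : ∀ a b → ℕtoℚ (a ℕ.+ b) ≡ ℕtoℚ a + ℕtoℚ b
ℕtoℚ-+ a b = trans (cong ℤtoℚ (ℤP.pos-+ a b)) (ℤtoℚ-+ (ℤ.+ a) (ℤ.+ b))

ℕtoℚ-* : ∀ a b → ℕtoℚ (a ℕ.* b) ≡ ℕtoℚ a * ℕtoℚ b
ℕtoℚ-* a b = trans (cong ℤtoℚ (ℤP.pos-* a b)) (ℤtoℚ-* (ℤ.+ a) (ℤ.+ b))

recip-inverse : ∀ m .{{_ : ℕ.NonZero m}} → ℕtoℚ m * recip m ≡ 1ℚ
recip-inverse (suc n) rewrite ℤtoℚ-normal (ℤ.+ suc n) =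
  trans (cong (q *_) (ℚP.normalize-coprime (Coprime.1-coprimeTo (suc n)))) (ℚP.*-inverseʳ q)
  where q = mkℚ (ℤ.+ suc n) 0 (Coprime.sym (Coprime.1-coprimeTo _))

recip-*-cancel : ∀ m a .{{_ : ℕ.NonZero m}} → recip m * (ℕtoℚ m * a) ≡ a
recip-*-cancel m a = begin
  recip m * (ℕtoℚ m * a)  ≡⟨ reassoc (recip m) (ℕtoℚ m) a ⟩
  (ℕtoℚ m * recip m) * a  ≡⟨ cong (_* a) (recip-inverse m) ⟩
  1ℚ * a                  ≡⟨ ℚP.*-identityˡ a ⟩
  a                       ∎
  where
  open ≡-Reasoning
  reassoc : ∀ r n a → r * (n * a) ≡ (n * r) * a
  reassoc = solve-∀ ℚ-ring

recip-unique : ∀ m y .{{_ : ℕ.NonZero m}} → ℕtoℚ m * y ≡ 1ℚ → y ≡ recip m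
recip-unique m y my≡1 = begin
  y                      ≡⟨ sym (recip-*-cancel m y) ⟩
  recip m * (ℕtoℚ m * y) ≡⟨ cong (recip m *_) my≡1 ⟩
  recip m * 1ℚ           ≡⟨ ℚP.*-identityʳ (recip m) ⟩
  recip m                ∎
  where open ≡-Reasoning

*-cancelˡ-nonZero : ∀ m a b .{{_ : ℕ.NonZero m}} → ℕtoℚ m * a ≡ ℕtoℚ m * b → a ≡ b
*-cancelˡ-nonZero m a b eq = begin
  a                      ≡⟨ sym (recip-*-cancel m a) ⟩
  recip m * (ℕtoℚ m * a) ≡⟨ cong (recip m *_) eq ⟩
  recip m * (ℕtoℚ m * b) ≡⟨ recip-*-cancel m b ⟩
  b                      ∎
  where open ≡-Reasoning

recip-factorial : ∀ m → recip (m !) * ℕtoℚ (m !) ≡ 1ℚ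
recip-factorial m = trans (ℚP.*-comm (recip (m !)) (ℕtoℚ (m !))) (recip-inverse (m !) {{ℕP._!≢0 m}})

-- (n+1) · 1/(n+1)! = 1/n!, the coefficient relation behind (e^t)' = e^t.
suc-*-recip-factorial : ∀ n → ℕtoℚ (suc n) * recip (suc n !) ≡ recip (n !)
suc-*-recip-factorial n = recip-unique (n !) _ {{ℕP._!≢0 n}} (begin
  ℕtoℚ (n !) * (ℕtoℚ (suc n) * recip (suc n !)) ≡⟨ reassoc (ℕtoℚ (n !)) (ℕtoℚ (suc n)) (recip (suc n !)) ⟩
  (ℕtoℚ (suc n) * ℕtoℚ (n !)) * recip (suc n !) ≡⟨ cong (_* recip (suc n !)) (sym (ℕtoℚ-* (suc n) (n !))) ⟩
  ℕtoℚ (suc n !) * recip (suc n !)              ≡⟨ recip-inverse (suc n !) {{ℕP._!≢0 (suc n)}} ⟩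
  1ℚ                                            ∎)
  where
  open ≡-Reasoning
  reassoc : ∀ a b c → a * (b * c) ≡ (b * a) * c
  reassoc = solve-∀ ℚ-ring

binomQ-factorials : ∀ {n k} → k ≤ n → binomQ n k * (ℕtoℚ (k !) * ℕtoℚ ((n ∸ k) !)) ≡ ℕtoℚ (n !)
binomQ-factorials {n} {k} k≤n = begin
  binomQ n k * (ℕtoℚ (k !) * ℕtoℚ ((n ∸ k) !)) ≡⟨ sym (cong (binomQ n k *_) (ℕtoℚ-* (k !) ((n ∸ k) !))) ⟩
  binomQ n k * ℕtoℚ (k ! ℕ.* (n ∸ k) !)        ≡⟨ sym (ℕtoℚ-* (n C k) (k ! ℕ.* (n ∸ k) !)) ⟩
  ℕtoℚ ((n C k) ℕ.* (k ! ℕ.* (n ∸ k) !))       ≡⟨ cong ℕtoℚ binom-factorials ⟩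
  ℕtoℚ (n !)                                   ∎
  where
  open ≡-Reasoning
  binom-factorials : (n C k) ℕ.* (k ! ℕ.* (n ∸ k) !) ≡ n !
  binom-factorials = trans (cong (ℕ._* (k ! ℕ.* (n ∸ k) !)) (nCk≡n!/k![n-k]! k≤n))
    (m/n*n≡m {{k ℕP.!* (n ∸ k) !≢0}} (subst (_∣ n !) (ℕP.*-comm ((n ∸ k) !) (k !)) ([n∸k]!k!∣n! k≤n)))

binomQ-factorial : ∀ {n k} → k ≤ n → binomQ n k * ℕtoℚ ((n ∸ k) !) ≡ ℕtoℚ (n !) * recip (k !)
binomQ-factorial {n} {k} k≤n = begin
  binomQ n k * ℕtoℚ ((n ∸ k) !)
    ≡⟨ sym (ℚP.*-identityʳ _) ⟩
  binomQ n k * ℕtoℚ ((n ∸ k) !) * 1ℚ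
    ≡⟨ cong (binomQ n k * ℕtoℚ ((n ∸ k) !) *_) (sym (recip-factorial k)) ⟩
  binomQ n k * ℕtoℚ ((n ∸ k) !) * (recip (k !) * ℕtoℚ (k !))
    ≡⟨ regroup (binomQ n k) (ℕtoℚ ((n ∸ k) !)) (recip (k !)) (ℕtoℚ (k !)) ⟩
  binomQ n k * (ℕtoℚ (k !) * ℕtoℚ ((n ∸ k) !)) * recip (k !)
    ≡⟨ cong (_* recip (k !)) (binomQ-factorials k≤n) ⟩
  ℕtoℚ (n !) * recip (k !) ∎
  where
  open ≡-Reasoning
  regroup : ∀ b f r g → b * f * (r * g) ≡ b * (g * f) * r
  regroup = solve-∀ ℚ-ring

sumTo-cong : ∀ n {f g : ℕ → ℚ} → (∀ i → i ≤ n → f i ≡ g i) → sumTo n f ≡ sumTo n g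
sumTo-cong zero    eq = eq 0 z≤n
sumTo-cong (suc n) eq =
  cong₂ _+_ (sumTo-cong n (λ i i≤n → eq i (ℕP.m≤n⇒m≤1+n i≤n))) (eq (suc n) ℕP.≤-refl)

sumTo-+ : ∀ n (f g : ℕ → ℚ) → sumTo n (λ i → f i + g i) ≡ sumTo n f + sumTo n g
sumTo-+ zero    f g = refl
sumTo-+ (suc n) f g =
  trans (cong (_+ (f (suc n) + g (suc n))) (sumTo-+ n f g))
        (interchange (sumTo n f) (sumTo n g) (f (suc n)) (g (suc n)))
  where
  interchange : ∀ a b c d → (a + b) + (c + d) ≡ (a + c) + (b + d)
  interchange = solve-∀ ℚ-ring

sumTo-*ˡ : ∀ n c (f : ℕ → ℚ) → sumTo n (λ i → c * f i) ≡ c * sumTo n f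
sumTo-*ˡ zero    c f = refl
sumTo-*ˡ (suc n) c f =
  trans (cong (_+ (c * f (suc n))) (sumTo-*ˡ n c f)) (sym (ℚP.*-distribˡ-+ c (sumTo n f) (f (suc n))))

sumTo-*ʳ : ∀ n c (f : ℕ → ℚ) → sumTo n (λ i → f i * c) ≡ sumTo n f * c
sumTo-*ʳ n c f = trans (sumTo-cong n (λ i _ → ℚP.*-comm (f i) c))
                       (trans (sumTo-*ˡ n c f) (ℚP.*-comm c _))

sumTo-neg : ∀ n (f : ℕ → ℚ) → sumTo n (λ i → - f i) ≡ - sumTo n f
sumTo-neg zero    f = refl
sumTo-neg (suc n) f =
  trans (cong (_+ (- f (suc n))) (sumTo-neg n f)) (sym (ℚP.neg-distrib-+ (sumTo n f) (f (suc n))))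

sumTo-− : ∀ n (f g : ℕ → ℚ) → sumTo n (λ i → f i - g i) ≡ sumTo n f - sumTo n g
sumTo-− n f g = trans (sumTo-+ n f (λ i → - g i)) (cong (sumTo n f +_) (sumTo-neg n g))

sumTo-zero : ∀ n (f : ℕ → ℚ) → (∀ i → i ≤ n → f i ≡ 0ℚ) → sumTo n f ≡ 0ℚ
sumTo-zero n f eq = trans (sumTo-cong n eq) (sumTo-const n)
  where
  sumTo-const : ∀ n → sumTo n (λ _ → 0ℚ) ≡ 0ℚ
  sumTo-const zero    = refl
  sumTo-const (suc n) = trans (cong (_+ 0ℚ) (sumTo-const n)) (ℚP.+-identityˡ 0ℚ)

sumTo-head : ∀ n (f : ℕ → ℚ) → sumTo (suc n) f ≡ f 0 + sumTo n (λ i → f (suc i))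
sumTo-head zero    f = refl
sumTo-head (suc n) f = trans (cong (_+ f (suc (suc n))) (sumTo-head n f)) (ℚP.+-assoc (f 0) _ _)

sumTo-drop-last : ∀ n (f : ℕ → ℚ) → f (suc n) ≡ 0ℚ → sumTo (suc n) f ≡ sumTo n f
sumTo-drop-last n f eq = trans (cong (sumTo n f +_) eq) (ℚP.+-identityʳ _)

sumTo-extend : ∀ m n (f : ℕ → ℚ) → m ≤ n → (∀ i → m < i → f i ≡ 0ℚ) → sumTo m f ≡ sumTo n f
sumTo-extend m n f m≤n vanish =
  trans (pad (n ∸ m)) (cong (λ z → sumTo z f) (ℕP.m∸n+n≡m m≤n))
  where
  pad : ∀ k → sumTo m f ≡ sumTo (k ℕ.+ m) f
  pad zero    = refl
  pad (suc k) = trans (pad k) (sym (sumTo-drop-last (k ℕ.+ m) f (vanish _ (s≤s (ℕP.m≤n+m m k)))))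

sumTo-reverse : ∀ n (f : ℕ → ℚ) → sumTo n f ≡ sumTo n (λ i → f (n ∸ i))
sumTo-reverse zero    f = refl
sumTo-reverse (suc n) f =
  trans (cong (_+ f (suc n)) (sumTo-reverse n f))
        (trans (ℚP.+-comm (sumTo n (λ i → f (n ∸ i))) (f (suc n)))
               (sym (sumTo-head n (λ i → f (suc n ∸ i)))))

sumTo-swap : ∀ a b (F : ℕ → ℕ → ℚ) →
  sumTo a (λ i → sumTo b (λ j → F i j)) ≡ sumTo b (λ j → sumTo a (λ i → F i j))
sumTo-swap zero    b F = refl
sumTo-swap (suc a) b F = trans (cong (_+ sumTo b (F (suc a))) (sumTo-swap a b F))
  (sym (sumTo-+ b (λ j → sumTo a (λ i → F i j)) (F (suc a))))

suc-∸ : ∀ {n i} → i ≤ n → suc n ∸ i ≡ suc (n ∸ i)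
suc-∸ i≤n = ℕP.+-∸-assoc 1 i≤n

sumTo-triangle : ∀ n (F : ℕ → ℕ → ℚ) →
  sumTo n (λ i → sumTo (n ∸ i) (F i)) ≡ sumTo n (λ m → sumTo m (λ i → F i (m ∸ i)))
sumTo-triangle zero    F = refl
sumTo-triangle (suc n) F = begin
  sumTo n (λ i → sumTo (suc n ∸ i) (F i)) + sumTo (n ∸ n) (F (suc n))
    ≡⟨ cong₂ _+_ (sumTo-cong n (λ i i≤n → cong (λ z → sumTo z (F i)) (suc-∸ i≤n)))
                 (cong (λ z → sumTo z (F (suc n))) (ℕP.n∸n≡0 n)) ⟩
  sumTo n (λ i → sumTo (n ∸ i) (F i) + F i (suc (n ∸ i))) + F (suc n) 0
    ≡⟨ cong (_+ F (suc n) 0) (sumTo-+ n _ _) ⟩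
  (sumTo n (λ i → sumTo (n ∸ i) (F i)) + sumTo n (λ i → F i (suc (n ∸ i)))) + F (suc n) 0
    ≡⟨ ℚP.+-assoc (sumTo n (λ i → sumTo (n ∸ i) (F i))) _ _ ⟩
  sumTo n (λ i → sumTo (n ∸ i) (F i)) + (sumTo n (λ i → F i (suc (n ∸ i))) + F (suc n) 0)
    ≡⟨ cong₂ _+_ (sumTo-triangle n F)
                 (cong₂ _+_ (sumTo-cong n (λ i i≤n → cong (F i) (sym (suc-∸ i≤n))))
                            (cong (F (suc n)) (sym (ℕP.n∸n≡0 n)))) ⟩
  sumTo n (λ m → sumTo m (λ i → F i (m ∸ i))) + sumTo (suc n) (λ i → F i (suc n ∸ i)) ∎
  where open ≡-Reasoning

-- The ring of formal power series PS = ℕ → ℚ under coefficientwise addition and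
-- the Cauchy product ⊛ of Defs.

-- Coefficientwise equality (a record, so that both sides can be inferred).
infix 4 _≈_
record _≈_ (f g : PS) : Set where
  constructor coeffwise
  field at : ∀ n → f n ≡ g n
open _≈_

infixl 6 _⊕_
_⊕_ : PS → PS → PS
(f ⊕ g) n = f n + g n

⊖_ : PS → PS
(⊖ f) n = - f n

0ₛ : PS
0ₛ _ = 0ℚ

1ₛ : PS
1ₛ zero    = 1ℚ
1ₛ (suc _) = 0ℚ

≈-refl : ∀ {f} → f ≈ f
≈-refl = coeffwise (λ _ → refl)

≈-sym : ∀ {f g} → f ≈ g → g ≈ f
≈-sym p = coeffwise (λ n → sym (at p n))

≈-trans : ∀ {f g h} → f ≈ g → g ≈ h → f ≈ h
≈-trans p q = coeffwise (λ n → trans (at p n) (at q n))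

⊕-cong : ∀ {f f′ g g′} → f ≈ f′ → g ≈ g′ → f ⊕ g ≈ f′ ⊕ g′
⊕-cong p q = coeffwise (λ n → cong₂ _+_ (at p n) (at q n))

⊛-cong : ∀ {f f′ g g′} → f ≈ f′ → g ≈ g′ → f ⊛ g ≈ f′ ⊛ g′
⊛-cong p q = coeffwise (λ n → sumTo-cong n (λ i _ → cong₂ _*_ (at p i) (at q (n ∸ i))))

⊛-comm : ∀ f g → f ⊛ g ≈ g ⊛ f
⊛-comm f g = coeffwise λ n → trans (sumTo-reverse n _)
  (sumTo-cong n (λ i i≤n → trans (cong (λ z → f (n ∸ i) * g z) (ℕP.m∸[m∸n]≡n i≤n))
                                 (ℚP.*-comm (f (n ∸ i)) (g i))))

⊛-distribˡ : ∀ f g h → f ⊛ (g ⊕ h) ≈ (f ⊛ g) ⊕ (f ⊛ h)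
⊛-distribˡ f g h = coeffwise λ n →
  trans (sumTo-cong n (λ i _ → ℚP.*-distribˡ-+ (f i) (g (n ∸ i)) (h (n ∸ i)))) (sumTo-+ n _ _)

⊛-assoc : ∀ f g h → (f ⊛ g) ⊛ h ≈ f ⊛ (g ⊛ h)
⊛-assoc f g h = coeffwise λ n → begin
  sumTo n (λ m → sumTo m (λ i → f i * g (m ∸ i)) * h (n ∸ m))
    ≡⟨ sumTo-cong n (λ m _ → sym (sumTo-*ʳ m (h (n ∸ m)) _)) ⟩
  sumTo n (λ m → sumTo m (λ i → f i * g (m ∸ i) * h (n ∸ m)))
    ≡⟨ sumTo-cong n (λ m m≤n → sumTo-cong m (λ i i≤m →
         trans (ℚP.*-assoc (f i) (g (m ∸ i)) (h (n ∸ m)))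
               (cong (λ z → f i * (g (m ∸ i) * h z)) (sym (∸-∸ i≤m m≤n))))) ⟩
  sumTo n (λ m → sumTo m (λ i → f i * (g (m ∸ i) * h (n ∸ i ∸ (m ∸ i)))))
    ≡⟨ sym (sumTo-triangle n (λ i j → f i * (g j * h (n ∸ i ∸ j)))) ⟩
  sumTo n (λ i → sumTo (n ∸ i) (λ j → f i * (g j * h (n ∸ i ∸ j))))
    ≡⟨ sumTo-cong n (λ i _ → sumTo-*ˡ (n ∸ i) (f i) _) ⟩
  sumTo n (λ i → f i * (g ⊛ h) (n ∸ i)) ∎
  where
  open ≡-Reasoning
  ∸-∸ : ∀ {n m i} → i ≤ m → m ≤ n → n ∸ i ∸ (m ∸ i) ≡ n ∸ m
  ∸-∸ {n} {m} {i} i≤m _ = trans (ℕP.∸-+-assoc n i (m ∸ i)) (cong (n ∸_) (ℕP.m+[n∸m]≡n i≤m))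

⊛-identityˡ : ∀ f → 1ₛ ⊛ f ≈ f
⊛-identityˡ f = coeffwise coefficient
  where
  open ≡-Reasoning
  coefficient : ∀ n → (1ₛ ⊛ f) n ≡ f n
  coefficient zero    = ℚP.*-identityˡ (f 0)
  coefficient (suc n) = begin
    sumTo (suc n) (λ i → 1ₛ i * f (suc n ∸ i))
      ≡⟨ sumTo-head n _ ⟩
    1ℚ * f (suc n) + sumTo n (λ i → 0ℚ * f (n ∸ i))
      ≡⟨ cong₂ _+_ (ℚP.*-identityˡ (f (suc n))) (sumTo-zero n _ (λ i _ → ℚP.*-zeroˡ (f (n ∸ i)))) ⟩
    f (suc n) + 0ℚ
      ≡⟨ ℚP.+-identityʳ _ ⟩
    f (suc n) ∎

PS-ring : CommutativeRing 0ℓ 0ℓ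
PS-ring = record
  { Carrier = PS ; _≈_ = _≈_ ; _+_ = _⊕_ ; _*_ = _⊛_ ; -_ = ⊖_ ; 0# = 0ₛ ; 1# = 1ₛ
  ; isCommutativeRing = record
    { isRing = record
      { +-isAbelianGroup = record
        { isGroup = record
          { isMonoid = record
            { isSemigroup = record
              { isMagma = record
                { isEquivalence = record { refl = ≈-refl ; sym = ≈-sym ; trans = ≈-trans }
                ; ∙-cong = ⊕-cong }
              ; assoc = λ f g h → coeffwise (λ n → ℚP.+-assoc (f n) (g n) (h n)) }
            ; identity = (λ f → coeffwise (λ n → ℚP.+-identityˡ (f n)))
                       , (λ f → coeffwise (λ n → ℚP.+-identityʳ (f n))) }
          ; inverse = (λ f → coeffwise (λ n → ℚP.+-inverseˡ (f n)))
                    , (λ f → coeffwise (λ n → ℚP.+-inverseʳ (f n)))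
          ; ⁻¹-cong = λ p → coeffwise (λ n → cong -_ (at p n)) }
        ; comm = λ f g → coeffwise (λ n → ℚP.+-comm (f n) (g n)) }
      ; *-cong = ⊛-cong
      ; *-assoc = ⊛-assoc
      ; *-identity = ⊛-identityˡ , (λ f → ≈-trans (⊛-comm f 1ₛ) (⊛-identityˡ f))
      ; distrib = ⊛-distribˡ
                , (λ f g h → ≈-trans (⊛-comm (g ⊕ h) f) (≈-trans (⊛-distribˡ f g h)
                    (coeffwise (λ n → cong₂ _+_ (at (⊛-comm f g) n) (at (⊛-comm f h) n))))) }
    ; *-comm = ⊛-comm } }

open CommutativeRing PS-ring
  using () renaming (setoid to PS-setoid; *-identityʳ to ⊛-identityʳ; zeroʳ to ⊛-zeroʳ;
                     distribʳ to ⊛-distribʳ)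

⊛-congˡ : ∀ h {f g} → f ≈ g → h ⊛ f ≈ h ⊛ g
⊛-congˡ h = ⊛-cong (≈-refl {h})

⊛-congʳ : ∀ h {f g} → f ≈ g → f ⊛ h ≈ g ⊛ h
⊛-congʳ h p = ⊛-cong p (≈-refl {h})

⊕-congˡ : ∀ h {f g} → f ≈ g → h ⊕ f ≈ h ⊕ g
⊕-congˡ h = ⊕-cong (≈-refl {h})

module PS-Solver = NatCoeffSolver (CommutativeRing.commutativeSemiring PS-ring) (λ _ _ → nothing)
open PS-Solver using (solve; _:+_; _:*_; _:=_)

module ≈-Reasoning = SetoidReasoning PS-setoid

tₛ : PS
tₛ zero          = 0ℚ
tₛ (suc zero)    = 1ℚ
tₛ (suc (suc _)) = 0ℚ

tₛ-⊛-zero : ∀ h → (tₛ ⊛ h) 0 ≡ 0ℚ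
tₛ-⊛-zero h = ℚP.*-zeroˡ (h 0)

tₛ-⊛-suc : ∀ h n → (tₛ ⊛ h) (suc n) ≡ h n
tₛ-⊛-suc h n = trans (sumTo-head n (λ i → tₛ i * h (suc n ∸ i)))
  (trans (cong₂ _+_ (ℚP.*-zeroˡ (h (suc n))) (select n h)) (ℚP.+-identityˡ (h n)))
  where
  select : ∀ n (h : PS) → sumTo n (λ i → tₛ (suc i) * h (n ∸ i)) ≡ h n
  select zero    h = ℚP.*-identityˡ (h 0)
  select (suc n) h = trans (sumTo-head n (λ i → tₛ (suc i) * h (suc n ∸ i)))
    (trans (cong₂ _+_ (ℚP.*-identityˡ (h (suc n))) (sumTo-zero n _ (λ i _ → ℚP.*-zeroˡ (h (n ∸ i)))))
           (ℚP.+-identityʳ (h (suc n))))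

tₛ-cancel : ∀ {f g} → tₛ ⊛ f ≈ tₛ ⊛ g → f ≈ g
tₛ-cancel {f} {g} p = coeffwise λ n →
  trans (sym (tₛ-⊛-suc f n)) (trans (at p (suc n)) (tₛ-⊛-suc g n))

psPow-zero : ∀ f → psPow f 0 ≈ 1ₛ
psPow-zero f = coeffwise λ where
  zero    → refl
  (suc n) → refl

psPow-cong : ∀ {f g} m → f ≈ g → psPow f m ≈ psPow g m
psPow-cong zero    p = ≈-refl
psPow-cong (suc m) p = ⊛-cong p (psPow-cong m p)

psPow-+ : ∀ f a b → psPow f (a ℕ.+ b) ≈ psPow f a ⊛ psPow f b
psPow-+ f zero    b = ≈-sym (≈-trans (⊛-congʳ (psPow f b) (psPow-zero f)) (⊛-identityˡ (psPow f b)))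
psPow-+ f (suc a) b = ≈-trans (⊛-congˡ f (psPow-+ f a b)) (≈-sym (⊛-assoc f (psPow f a) (psPow f b)))

psPow-⊛ : ∀ f g i → psPow (f ⊛ g) i ≈ psPow f i ⊛ psPow g i
psPow-⊛ f g zero    = ≈-trans (psPow-zero (f ⊛ g))
  (≈-sym (≈-trans (⊛-cong (psPow-zero f) (psPow-zero g)) (⊛-identityˡ 1ₛ)))
psPow-⊛ f g (suc i) = ≈-trans (⊛-congˡ (f ⊛ g) (psPow-⊛ f g i)) (interchange f g (psPow f i) (psPow g i))
  where
  interchange : ∀ a b c d → (a ⊛ b) ⊛ (c ⊛ d) ≈ (a ⊛ c) ⊛ (b ⊛ d)
  interchange = solve 4 (λ a b c d → (a :* b) :* (c :* d) := (a :* c) :* (b :* d)) ≈-refl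

psPow-order : ∀ f → f 0 ≡ 0ℚ → ∀ i m → m < i → psPow f i m ≡ 0ℚ
psPow-order f f0 (suc i) m (s≤s m≤i) = sumTo-zero m _ (term m m≤i)
  where
  term : ∀ m → m ≤ i → ∀ j → j ≤ m → f j * psPow f i (m ∸ j) ≡ 0ℚ
  term m _ zero _ = trans (cong (_* psPow f i m) f0) (ℚP.*-zeroˡ (psPow f i m))
  term (suc m) m<i (suc j) _ = trans
    (cong (f (suc j) *_) (psPow-order f f0 i (m ∸ j) (ℕP.≤-trans (s≤s (ℕP.m∸n≤m m j)) m<i)))
    (ℚP.*-zeroʳ (f (suc j)))

tₛ-pow-shift : ∀ i j h → (psPow tₛ i ⊛ h) (i ℕ.+ j) ≡ h j
tₛ-pow-shift zero    j h = at (≈-trans (⊛-congʳ h (psPow-zero tₛ)) (⊛-identityˡ h)) j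
tₛ-pow-shift (suc i) j h = trans (at (⊛-assoc tₛ (psPow tₛ i) h) (suc (i ℕ.+ j)))
  (trans (tₛ-⊛-suc (psPow tₛ i ⊛ h) (i ℕ.+ j)) (tₛ-pow-shift i j h))

infixr 7 _·ₛ_
_·ₛ_ : ℚ → PS → PS
(c ·ₛ f) n = c * f n

⊛-·ₛ : ∀ f c h → f ⊛ (c ·ₛ h) ≈ c ·ₛ (f ⊛ h)
⊛-·ₛ f c h = coeffwise λ n →
  trans (sumTo-cong n (λ i _ → swap (f i) c (h (n ∸ i)))) (sumTo-*ˡ n c _)
  where
  swap : ∀ a c b → a * (c * b) ≡ c * (a * b)
  swap = solve-∀ ℚ-ring

·ₛ-suc : ∀ m h → h ⊕ ℕtoℚ m ·ₛ h ≈ ℕtoℚ (suc m) ·ₛ h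
·ₛ-suc m h = coeffwise λ n →
  trans (add-one (h n) (ℕtoℚ m)) (cong (_* h n) (sym (ℕtoℚ-+ 1 m)))
  where
  add-one : ∀ a c → a + c * a ≡ (1ℚ + c) * a
  add-one = solve-∀ ℚ-ring

∂ : PS → PS
∂ f n = ℕtoℚ (suc n) * f (suc n)

∂-cong : ∀ {f g} → f ≈ g → ∂ f ≈ ∂ g
∂-cong p = coeffwise λ n → cong (ℕtoℚ (suc n) *_) (at p (suc n))

∂-1 : ∂ 1ₛ ≈ 0ₛ
∂-1 = coeffwise λ n → ℚP.*-zeroʳ (ℕtoℚ (suc n))

-- The product rule. The coefficient (n+1) f_i g_{n+1-i} is split as
-- i·f_i g_{n+1-i} + (n+1-i)·f_i g_{n+1-i}, giving the two convolutions.
leibniz : ∀ f g → ∂ (f ⊛ g) ≈ (∂ f ⊛ g) ⊕ (f ⊛ ∂ g)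
leibniz f g = coeffwise λ n → begin
  ℕtoℚ (suc n) * sumTo (suc n) (term n)
    ≡⟨ sym (sumTo-*ˡ (suc n) (ℕtoℚ (suc n)) (term n)) ⟩
  sumTo (suc n) (λ i → ℕtoℚ (suc n) * term n i)
    ≡⟨ sumTo-cong (suc n) (λ i i≤ → split-weight n i i≤) ⟩
  sumTo (suc n) (λ i → ℕtoℚ i * term n i + ℕtoℚ (suc n ∸ i) * term n i)
    ≡⟨ sumTo-+ (suc n) _ _ ⟩
  sumTo (suc n) (λ i → ℕtoℚ i * term n i) + sumTo (suc n) (λ i → ℕtoℚ (suc n ∸ i) * term n i)
    ≡⟨ cong₂ _+_ (left-part n) (right-part n) ⟩
  (∂ f ⊛ g) n + (f ⊛ ∂ g) n ∎
  where
  open ≡-Reasoning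
  term : ℕ → ℕ → ℚ
  term n i = f i * g (suc n ∸ i)
  split-weight : ∀ n i → i ≤ suc n → ℕtoℚ (suc n) * term n i ≡ ℕtoℚ i * term n i + ℕtoℚ (suc n ∸ i) * term n i
  split-weight n i i≤ = begin
    ℕtoℚ (suc n) * term n i                 ≡⟨ cong (λ z → ℕtoℚ z * term n i) (sym (ℕP.m+[n∸m]≡n i≤)) ⟩
    ℕtoℚ (i ℕ.+ (suc n ∸ i)) * term n i     ≡⟨ cong (_* term n i) (ℕtoℚ-+ i (suc n ∸ i)) ⟩
    (ℕtoℚ i + ℕtoℚ (suc n ∸ i)) * term n i  ≡⟨ ℚP.*-distribʳ-+ (term n i) (ℕtoℚ i) _ ⟩
    ℕtoℚ i * term n i + ℕtoℚ (suc n ∸ i) * term n i ∎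
  left-part : ∀ n → sumTo (suc n) (λ i → ℕtoℚ i * term n i) ≡ (∂ f ⊛ g) n
  left-part n = begin
    sumTo (suc n) (λ i → ℕtoℚ i * term n i)
      ≡⟨ sumTo-head n _ ⟩
    ℕtoℚ 0 * term n 0 + sumTo n (λ i → ℕtoℚ (suc i) * term n (suc i))
      ≡⟨ cong (_+ sumTo n (λ i → ℕtoℚ (suc i) * term n (suc i))) (ℚP.*-zeroˡ (term n 0)) ⟩
    0ℚ + sumTo n (λ i → ℕtoℚ (suc i) * term n (suc i))
      ≡⟨ ℚP.+-identityˡ _ ⟩
    sumTo n (λ i → ℕtoℚ (suc i) * term n (suc i))
      ≡⟨ sumTo-cong n (λ i _ → sym (ℚP.*-assoc (ℕtoℚ (suc i)) (f (suc i)) (g (n ∸ i)))) ⟩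
    (∂ f ⊛ g) n ∎
  right-part : ∀ n → sumTo (suc n) (λ i → ℕtoℚ (suc n ∸ i) * term n i) ≡ (f ⊛ ∂ g) n
  right-part n = trans
    (sumTo-drop-last n _ (trans (cong (λ z → ℕtoℚ z * term n (suc n)) (ℕP.n∸n≡0 n))
                                (ℚP.*-zeroˡ (term n (suc n)))))
    (sumTo-cong n λ i i≤n → trans
      (cong (λ z → ℕtoℚ z * (f i * g z)) (suc-∸ i≤n))
      (swap (ℕtoℚ (suc (n ∸ i))) (f i) (g (suc (n ∸ i)))))
    where
    swap : ∀ a b c → a * (b * c) ≡ b * (a * c)
    swap = solve-∀ ℚ-ring

∂-pow : ∀ f m → ∂ (psPow f (suc m)) ≈ ℕtoℚ (suc m) ·ₛ (psPow f m ⊛ ∂ f)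
∂-pow f zero = begin
  ∂ (f ⊛ psPow f 0)        ≈⟨ ∂-cong (≈-trans (⊛-congˡ f (psPow-zero f)) (⊛-identityʳ f)) ⟩
  ∂ f                      ≈⟨ ⊛-identityˡ (∂ f) ⟨
  1ₛ ⊛ ∂ f                 ≈⟨ ⊛-congʳ (∂ f) (psPow-zero f) ⟨
  psPow f 0 ⊛ ∂ f          ≈⟨ coeffwise (λ n → ℚP.*-identityˡ ((psPow f 0 ⊛ ∂ f) n)) ⟨
  ℕtoℚ 1 ·ₛ (psPow f 0 ⊛ ∂ f) ∎
  where open ≈-Reasoning
∂-pow f (suc m) = begin
  ∂ (f ⊛ P)                                   ≈⟨ leibniz f P ⟩
  (∂ f ⊛ P) ⊕ (f ⊛ ∂ P)                       ≈⟨ ⊕-congˡ (∂ f ⊛ P) (⊛-congˡ f (∂-pow f m)) ⟩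
  (∂ f ⊛ P) ⊕ (f ⊛ (ℕtoℚ (suc m) ·ₛ (psPow f m ⊛ ∂ f)))
    ≈⟨ ⊕-congˡ (∂ f ⊛ P) (⊛-·ₛ f (ℕtoℚ (suc m)) (psPow f m ⊛ ∂ f)) ⟩
  (∂ f ⊛ P) ⊕ (ℕtoℚ (suc m) ·ₛ (f ⊛ (psPow f m ⊛ ∂ f)))
    ≈⟨ ⊕-cong (⊛-comm (∂ f) P) (coeffwise λ n → cong (ℕtoℚ (suc m) *_)
                                   (at (≈-sym (⊛-assoc f (psPow f m) (∂ f))) n)) ⟩
  (P ⊛ ∂ f) ⊕ (ℕtoℚ (suc m) ·ₛ (P ⊛ ∂ f))     ≈⟨ ·ₛ-suc (suc m) (P ⊛ ∂ f) ⟩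
  ℕtoℚ (suc (suc m)) ·ₛ (P ⊛ ∂ f)             ∎
  where
  open ≈-Reasoning
  P = psPow f (suc m)

invUpTo-sum : ∀ f m (h : ℕ → ℚ) →
  foldr _+_ 0ℚ (zipWith _*_ (applyUpTo h (suc m)) (invUpTo f m)) ≡ sumTo m (λ i → h i * psInv f (m ∸ i))
invUpTo-sum f zero    h = ℚP.+-identityʳ _
invUpTo-sum f (suc m) h =
  trans (cong (h 0 * psInv f (suc m) +_) (invUpTo-sum f m (λ i → h (suc i))))
        (sym (sumTo-head m (λ i → h i * psInv f (suc m ∸ i))))

psInv-inverse : ∀ f → f 0 ≡ 1ℚ → f ⊛ psInv f ≈ 1ₛ
psInv-inverse f f0≡1 = coeffwise coefficient
  where
  open ≡-Reasoning
  coefficient : ∀ n → (f ⊛ psInv f) n ≡ 1ₛ n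
  coefficient zero    = cong (_* 1ℚ) f0≡1
  coefficient (suc m) = begin
    sumTo (suc m) (λ i → f i * psInv f (suc m ∸ i))
      ≡⟨ sumTo-head m _ ⟩
    f 0 * psInv f (suc m) + S
      ≡⟨ cong (λ z → z * psInv f (suc m) + S) f0≡1 ⟩
    1ℚ * (- foldr _+_ 0ℚ (zipWith _*_ (applyUpTo (λ i → f (suc i)) (suc m)) (invUpTo f m))) + S
      ≡⟨ cong (λ z → 1ℚ * (- z) + S) (invUpTo-sum f m (λ i → f (suc i))) ⟩
    1ℚ * (- S) + S
      ≡⟨ cancel S ⟩
    0ℚ ∎
    where
    S = sumTo m (λ i → f (suc i) * psInv f (m ∸ i))
    cancel : ∀ s → 1ℚ * (- s) + s ≡ 0ℚ
    cancel = solve-∀ ℚ-ring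

psInv-unique : ∀ f h → f 0 ≡ 1ℚ → f ⊛ h ≈ 1ₛ → h ≈ psInv f
psInv-unique f h f0≡1 fh≈1 = begin
  h                    ≈⟨ ⊛-identityˡ h ⟨
  1ₛ ⊛ h               ≈⟨ ⊛-congʳ h (≈-trans (⊛-comm (psInv f) f) (psInv-inverse f f0≡1)) ⟨
  (psInv f ⊛ f) ⊛ h    ≈⟨ ⊛-assoc (psInv f) f h ⟩
  psInv f ⊛ (f ⊛ h)    ≈⟨ ⊛-congˡ (psInv f) fh≈1 ⟩
  psInv f ⊛ 1ₛ         ≈⟨ ⊛-identityʳ (psInv f) ⟩
  psInv f              ∎
  where open ≈-Reasoning

-- Composition F∘g with a series g of order ≥ 1

module Composition (g : PS) (g-order : g 0 ≡ 0ℚ) where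

  -- [t^m] (F∘g) = Σ_i F_i [t^m] g^i, where only i ≤ m contribute.
  compose : PS → PS
  compose F m = sumTo m (λ i → F i * psPow g i m)

  g-pow-order : ∀ i m → m < i → psPow g i m ≡ 0ℚ
  g-pow-order = psPow-order g g-order

  compose-extend : ∀ F {m n} → m ≤ n → compose F m ≡ sumTo n (λ i → F i * psPow g i m)
  compose-extend F {m} {n} m≤n = sumTo-extend m n _ m≤n
    (λ i m<i → trans (cong (F i *_) (g-pow-order i m m<i)) (ℚP.*-zeroʳ (F i)))

  compose-cong : ∀ {F G} → F ≈ G → compose F ≈ compose G
  compose-cong p = coeffwise λ m → sumTo-cong m (λ i _ → cong (_* psPow g i m) (at p i))

  compose-⊕ : ∀ F G → compose (F ⊕ G) ≈ compose F ⊕ compose G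
  compose-⊕ F G = coeffwise λ m →
    trans (sumTo-cong m (λ i _ → ℚP.*-distribʳ-+ (psPow g i m) (F i) (G i))) (sumTo-+ m _ _)

  compose-1 : compose 1ₛ ≈ 1ₛ
  compose-1 = coeffwise coefficient
    where
    coefficient : ∀ m → compose 1ₛ m ≡ 1ₛ m
    coefficient zero    = ℚP.*-identityˡ 1ℚ
    coefficient (suc m) = trans (sumTo-head m _)
      (trans (cong₂ _+_ (ℚP.*-identityˡ 0ℚ) (sumTo-zero m _ (λ i _ → ℚP.*-zeroˡ (psPow g (suc i) (suc m)))))
             (ℚP.+-identityˡ 0ℚ))

  compose-⊛ : ∀ F h n → (compose F ⊛ h) n ≡ sumTo n (λ i → F i * (psPow g i ⊛ h) n)
  compose-⊛ F h n = begin
    sumTo n (λ j → compose F j * h (n ∸ j))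
      ≡⟨ sumTo-cong n (λ j j≤n → cong (_* h (n ∸ j)) (compose-extend F j≤n)) ⟩
    sumTo n (λ j → sumTo n (λ i → F i * psPow g i j) * h (n ∸ j))
      ≡⟨ sumTo-cong n (λ j _ → sym (sumTo-*ʳ n (h (n ∸ j)) _)) ⟩
    sumTo n (λ j → sumTo n (λ i → F i * psPow g i j * h (n ∸ j)))
      ≡⟨ sumTo-swap n n (λ j i → F i * psPow g i j * h (n ∸ j)) ⟩
    sumTo n (λ i → sumTo n (λ j → F i * psPow g i j * h (n ∸ j)))
      ≡⟨ sumTo-cong n (λ i _ → trans (sumTo-cong n (λ j _ → ℚP.*-assoc (F i) (psPow g i j) (h (n ∸ j))))
                                     (sumTo-*ˡ n (F i) _)) ⟩
    sumTo n (λ i → F i * (psPow g i ⊛ h) n) ∎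
    where open ≡-Reasoning

  compose-shift : ∀ F → F 0 ≡ 0ℚ → compose (λ i → F (suc i)) ⊛ g ≈ compose F
  compose-shift F F0≡0 = coeffwise λ n → begin
    (compose (λ i → F (suc i)) ⊛ g) n
      ≡⟨ compose-⊛ (λ i → F (suc i)) g n ⟩
    sumTo n (λ i → F (suc i) * (psPow g i ⊛ g) n)
      ≡⟨ sumTo-cong n (λ i _ → cong (F (suc i) *_) (at (⊛-comm (psPow g i) g) n)) ⟩
    sumTo n (λ i → F (suc i) * psPow g (suc i) n)
      ≡⟨ sym (ℚP.+-identityˡ _) ⟩
    0ℚ + sumTo n (λ i → F (suc i) * psPow g (suc i) n)
      ≡⟨ cong (_+ sumTo n (λ i → F (suc i) * psPow g (suc i) n))
              (sym (trans (cong (_* psPow g 0 n) F0≡0) (ℚP.*-zeroˡ (psPow g 0 n)))) ⟩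
    F 0 * psPow g 0 n + sumTo n (λ i → F (suc i) * psPow g (suc i) n)
      ≡⟨ sym (sumTo-head n _) ⟩
    sumTo (suc n) (λ i → F i * psPow g i n)
      ≡⟨ sym (compose-extend F (ℕP.n≤1+n n)) ⟩
    compose F n ∎
    where open ≡-Reasoning

  chain-rule : ∀ F → ∂ (compose F) ≈ compose (∂ F) ⊛ ∂ g
  chain-rule F = coeffwise λ n → begin
    ℕtoℚ (suc n) * sumTo (suc n) (λ i → F i * psPow g i (suc n))
      ≡⟨ sym (sumTo-*ˡ (suc n) (ℕtoℚ (suc n)) _) ⟩
    sumTo (suc n) (λ i → ℕtoℚ (suc n) * (F i * psPow g i (suc n)))
      ≡⟨ sumTo-cong (suc n) (λ i _ → swap (ℕtoℚ (suc n)) (F i) (psPow g i (suc n))) ⟩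
    sumTo (suc n) (λ i → F i * ∂ (psPow g i) n)
      ≡⟨ sumTo-head n _ ⟩
    F 0 * ∂ (psPow g 0) n + sumTo n (λ i → F (suc i) * ∂ (psPow g (suc i)) n)
      ≡⟨ cong₂ _+_ (trans (cong (F 0 *_) (at (≈-trans (∂-cong (psPow-zero g)) ∂-1) n)) (ℚP.*-zeroʳ (F 0)))
                   (sumTo-cong n (λ i _ → trans (cong (F (suc i) *_) (at (∂-pow g i) n))
                                                (reorder (F (suc i)) (ℕtoℚ (suc i)) _))) ⟩
    0ℚ + sumTo n (λ i → ∂ F i * (psPow g i ⊛ ∂ g) n)
      ≡⟨ ℚP.+-identityˡ _ ⟩
    sumTo n (λ i → ∂ F i * (psPow g i ⊛ ∂ g) n)
      ≡⟨ sym (compose-⊛ (∂ F) (∂ g) n) ⟩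
    (compose (∂ F) ⊛ ∂ g) n ∎
    where
    open ≡-Reasoning
    swap : ∀ a b c → a * (b * c) ≡ b * (a * c)
    swap = solve-∀ ℚ-ring
    reorder : ∀ a b c → a * (b * c) ≡ b * a * c
    reorder = solve-∀ ℚ-ring

-- The exponential series and φ = t/(e^t - 1)

expₛ : PS
expₛ n = recip (n !)

-- E = (e^t - 1)/t, its inverse φ = t/(e^t - 1), and ψ = e^t - 1 = t E.
E φ ψ : PS
E = expMinusOneOverT
φ = tOverExpMinusOne
ψ = tₛ ⊛ E

E-φ : E ⊛ φ ≈ 1ₛ
E-φ = psInv-inverse E refl

φ-E : φ ⊛ E ≈ 1ₛ
φ-E = ≈-trans (⊛-comm φ E) E-φ

φ-ψ : φ ⊛ ψ ≈ tₛ
φ-ψ = begin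
  φ ⊛ (tₛ ⊛ E)  ≈⟨ rearrange φ tₛ E ⟩
  tₛ ⊛ (φ ⊛ E)  ≈⟨ ⊛-congˡ tₛ φ-E ⟩
  tₛ ⊛ 1ₛ       ≈⟨ ⊛-identityʳ tₛ ⟩
  tₛ            ∎
  where
  open ≈-Reasoning
  rearrange : ∀ a b c → a ⊛ (b ⊛ c) ≈ b ⊛ (a ⊛ c)
  rearrange = solve 3 (λ a b c → a :* (b :* c) := b :* (a :* c)) ≈-refl

∂-ψ : ∂ ψ ≈ expₛ
∂-ψ = coeffwise λ n → trans (cong (ℕtoℚ (suc n) *_) (tₛ-⊛-suc E n)) (suc-*-recip-factorial n)

1+ψ : 1ₛ ⊕ ψ ≈ expₛ
1+ψ = coeffwise coefficient
  where
  coefficient : ∀ n → (1ₛ ⊕ ψ) n ≡ expₛ n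
  coefficient zero    = cong (1ℚ +_) (tₛ-⊛-zero E)
  coefficient (suc n) = trans (cong (0ℚ +_) (tₛ-⊛-suc E n)) (ℚP.+-identityˡ (E n))

E+tE′ : E ⊕ (tₛ ⊛ ∂ E) ≈ expₛ
E+tE′ = coeffwise coefficient
  where
  open ≡-Reasoning
  coefficient : ∀ n → (E ⊕ (tₛ ⊛ ∂ E)) n ≡ expₛ n
  coefficient zero    = cong (E 0 +_) (tₛ-⊛-zero (∂ E))
  coefficient (suc n) = begin
    E (suc n) + (tₛ ⊛ ∂ E) (suc n)           ≡⟨ cong (E (suc n) +_) (tₛ-⊛-suc (∂ E) n) ⟩
    E (suc n) + ℕtoℚ (suc n) * E (suc n)     ≡⟨ add-one (E (suc n)) (ℕtoℚ (suc n)) ⟩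
    (1ℚ + ℕtoℚ (suc n)) * E (suc n)          ≡⟨ cong (_* E (suc n)) (sym (ℕtoℚ-+ 1 (suc n))) ⟩
    ℕtoℚ (suc (suc n)) * recip (suc (suc n) !) ≡⟨ suc-*-recip-factorial (suc n) ⟩
    expₛ (suc n)                             ∎
    where
    add-one : ∀ a b → a + b * a ≡ (1ℚ + b) * a
    add-one = solve-∀ ℚ-ring

-- The differential equation e^t φ² + t φ' = φ, obtained by differentiating E φ = 1.
φ-ode : (expₛ ⊛ (φ ⊛ φ)) ⊕ (tₛ ⊛ ∂ φ) ≈ φ
φ-ode = begin
  (expₛ ⊛ (φ ⊛ φ)) ⊕ (tₛ ⊛ ∂ φ)
    ≈⟨ ⊕-cong (⊛-congʳ (φ ⊛ φ) E+tE′) (⊛-congˡ tₛ (≈-trans (⊛-congʳ (∂ φ) φ-E) (⊛-identityˡ (∂ φ)))) ⟨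
  ((E ⊕ (tₛ ⊛ ∂ E)) ⊛ (φ ⊛ φ)) ⊕ (tₛ ⊛ ((φ ⊛ E) ⊛ ∂ φ))
    ≈⟨ rearrange E tₛ (∂ E) φ (∂ φ) ⟩
  ((E ⊛ φ) ⊛ φ) ⊕ ((tₛ ⊛ φ) ⊛ ((∂ E ⊛ φ) ⊕ (E ⊛ ∂ φ)))
    ≈⟨ ⊕-cong (⊛-congʳ φ E-φ) (⊛-congˡ (tₛ ⊛ φ) ∂[Eφ]≈0) ⟩
  (1ₛ ⊛ φ) ⊕ ((tₛ ⊛ φ) ⊛ 0ₛ)
    ≈⟨ coeffwise (λ n → trans (cong₂ _+_ (at (⊛-identityˡ φ) n) (at (⊛-zeroʳ (tₛ ⊛ φ)) n)) (ℚP.+-identityʳ (φ n))) ⟩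
  φ ∎
  where
  open ≈-Reasoning
  rearrange : ∀ e t de f df →
    ((e ⊕ (t ⊛ de)) ⊛ (f ⊛ f)) ⊕ (t ⊛ ((f ⊛ e) ⊛ df)) ≈ ((e ⊛ f) ⊛ f) ⊕ ((t ⊛ f) ⊛ ((de ⊛ f) ⊕ (e ⊛ df)))
  rearrange = solve 5 (λ e t de f df →
    ((e :+ (t :* de)) :* (f :* f)) :+ (t :* ((f :* e) :* df)) := ((e :* f) :* f) :+ ((t :* f) :* ((de :* f) :+ (e :* df)))) ≈-refl
  ∂[Eφ]≈0 : (∂ E ⊛ φ) ⊕ (E ⊛ ∂ φ) ≈ 0ₛ
  ∂[Eφ]≈0 = ≈-trans (≈-sym (leibniz E φ)) (≈-trans (∂-cong E-φ) ∂-1)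

-- [t^m] f^m f' = [t^{m+1}] f^{m+1}: both equal [t^m] (f^{m+1})' / (m+1).
pow-∂-diagonal : ∀ f m → (psPow f m ⊛ ∂ f) m ≡ psPow f (suc m) (suc m)
pow-∂-diagonal f m = *-cancelˡ-nonZero (suc m) _ _ (sym (at (∂-pow f m) m))

-- [t^n] e^t φ^{n+1} = δ_{n0}; for n = m+1 this is the ODE multiplied by φ^m,
-- read at t^{m+1}.
exp-φ-pow-diagonal : ∀ n → (expₛ ⊛ psPow φ (suc n)) n ≡ 1ₛ n
exp-φ-pow-diagonal zero    = refl
exp-φ-pow-diagonal (suc m) = x+y≡y⇒x≡0 (begin
  (expₛ ⊛ psPow φ (suc (suc m))) (suc m) + psPow φ (suc m) (suc m)
    ≡⟨ cong₂ _+_ (sym (at eφφP (suc m))) (trans (sym (pow-∂-diagonal φ m)) (sym (tₛ-⊛-suc (P ⊛ ∂ φ) m))) ⟩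
  ((expₛ ⊛ (φ ⊛ φ)) ⊛ P) (suc m) + (tₛ ⊛ (P ⊛ ∂ φ)) (suc m)
    ≡⟨ at ode-times-P (suc m) ⟩
  psPow φ (suc m) (suc m) ∎)
  where
  open ≡-Reasoning
  P = psPow φ m
  x+y≡y⇒x≡0 : ∀ {x y} → x + y ≡ y → x ≡ 0ℚ
  x+y≡y⇒x≡0 {x} {y} eq = trans (add-sub x y) (trans (cong (_- y) eq) (ℚP.+-inverseʳ y))
    where
    add-sub : ∀ a b → a ≡ (a + b) - b
    add-sub = solve-∀ ℚ-ring
  eφφP : (expₛ ⊛ (φ ⊛ φ)) ⊛ P ≈ expₛ ⊛ psPow φ (suc (suc m))
  eφφP = ≈-trans (⊛-assoc expₛ (φ ⊛ φ) P) (⊛-congˡ expₛ (⊛-assoc φ φ P))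
  ode-times-P : ((expₛ ⊛ (φ ⊛ φ)) ⊛ P) ⊕ (tₛ ⊛ (P ⊛ ∂ φ)) ≈ φ ⊛ P
  ode-times-P = ≈-trans (distribute (expₛ ⊛ (φ ⊛ φ)) tₛ P (∂ φ)) (⊛-congʳ P φ-ode)
    where
    distribute : ∀ a t p d → (a ⊛ p) ⊕ (t ⊛ (p ⊛ d)) ≈ (a ⊕ (t ⊛ d)) ⊛ p
    distribute = solve 4 (λ a t p d → (a :* p) :+ (t :* (p :* d)) := (a :+ (t :* d)) :* p) ≈-refl

L G T : PS
L = logOnePlus
G = onePlusTimesLogOverT
T = tOverOnePlusLog

∂-L : ∂ L ≈ sgn
∂-L = coeffwise λ n →
  trans (swap (ℕtoℚ (suc n)) (sgn n) (recip (suc n)))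
        (trans (cong (sgn n *_) (recip-inverse (suc n))) (ℚP.*-identityʳ (sgn n)))
  where
  swap : ∀ a b c → a * (b * c) ≡ b * (a * c)
  swap = solve-∀ ℚ-ring

open Composition ψ (tₛ-⊛-zero E)

-- 1/(1+ψ) · e^t = 1, because (1 + t) Σ (-1)^n t^n = 1 and 1 + ψ = e^t.
compose-sgn-exp : compose sgn ⊛ expₛ ≈ 1ₛ
compose-sgn-exp = begin
  compose sgn ⊛ expₛ                        ≈⟨ ⊛-congˡ (compose sgn) 1+ψ ⟨
  compose sgn ⊛ (1ₛ ⊕ ψ)                    ≈⟨ ⊛-distribˡ (compose sgn) 1ₛ ψ ⟩
  (compose sgn ⊛ 1ₛ) ⊕ (compose sgn ⊛ ψ)    ≈⟨ ⊕-cong (⊛-identityʳ (compose sgn)) (compose-shift t-sgn refl) ⟩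
  compose sgn ⊕ compose t-sgn               ≈⟨ compose-⊕ sgn t-sgn ⟨
  compose (sgn ⊕ t-sgn)                     ≈⟨ compose-cong sgn+t-sgn ⟩
  compose 1ₛ                                ≈⟨ compose-1 ⟩
  1ₛ                                        ∎
  where
  open ≈-Reasoning
  t-sgn : PS
  t-sgn zero    = 0ℚ
  t-sgn (suc i) = sgn i
  sgn+t-sgn : sgn ⊕ t-sgn ≈ 1ₛ
  sgn+t-sgn = coeffwise λ where
    zero    → refl
    (suc i) → ℚP.+-inverseˡ (sgn i)

-- log(1 + ψ) = t: both sides vanish at 0 and have derivative 1.
log-compose : compose L ≈ tₛ
log-compose = coeffwise coefficient
  where
  ∂-log-compose : ∂ (compose L) ≈ 1ₛ
  ∂-log-compose = ≈-trans (chain-rule L) (≈-trans (⊛-cong (compose-cong ∂-L) ∂-ψ) compose-sgn-exp)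
  coefficient : ∀ n → compose L n ≡ tₛ n
  coefficient zero          = refl
  coefficient (suc zero)    = trans (sym (ℚP.*-identityˡ (compose L 1))) (at ∂-log-compose 0)
  coefficient (suc (suc k)) = *-cancelˡ-nonZero (suc (suc k)) _ _
    (trans (at ∂-log-compose (suc k)) (sym (ℚP.*-zeroʳ (ℕtoℚ (suc (suc k))))))

-- G(ψ) · ψ = (1 + ψ) log(1 + ψ) = t e^t.
G-compose-ψ : compose G ⊛ ψ ≈ tₛ ⊛ expₛ
G-compose-ψ = begin
  compose G ⊛ ψ                                       ≈⟨ ⊛-congʳ ψ (compose-⊕ L/t L) ⟩
  (compose L/t ⊕ compose L) ⊛ ψ                       ≈⟨ ⊛-distribʳ ψ (compose L/t) (compose L) ⟩
  (compose L/t ⊛ ψ) ⊕ (compose L ⊛ ψ)                 ≈⟨ ⊕-cong (compose-shift L refl) (⊛-congʳ ψ log-compose) ⟩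
  compose L ⊕ (tₛ ⊛ ψ)                                ≈⟨ ⊕-cong (≈-trans log-compose (≈-sym (⊛-identityʳ tₛ))) ≈-refl ⟩
  (tₛ ⊛ 1ₛ) ⊕ (tₛ ⊛ ψ)                                ≈⟨ ⊛-distribˡ tₛ 1ₛ ψ ⟨
  tₛ ⊛ (1ₛ ⊕ ψ)                                       ≈⟨ ⊛-congˡ tₛ 1+ψ ⟩
  tₛ ⊛ expₛ                                           ∎
  where
  open ≈-Reasoning
  L/t : PS
  L/t i = L (suc i)

G-compose-E : compose G ⊛ E ≈ expₛ
G-compose-E = tₛ-cancel (≈-trans (rearrange tₛ (compose G) E) G-compose-ψ)
  where
  rearrange : ∀ a b c → a ⊛ (b ⊛ c) ≈ b ⊛ (a ⊛ c)
  rearrange = solve 3 (λ a b c → a :* (b :* c) := b :* (a :* c)) ≈-refl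

-- The Bernoulli identity  t/((1+t)log(1+t)) = Σ_m B_m^{(m)} t^m / m!

-- The diagonal coefficients [t^m] φ^m = B_m^{(m)} / m!.
diag : PS
diag m = psPow φ m m

-- [t^j] φ^j = [t^{i+j}] ψ^i φ^{i+j}, because ψ^i φ^{i+j} = t^i φ^j.
diag-via-ψ : ∀ i j → diag j ≡ (psPow ψ i ⊛ psPow φ (i ℕ.+ j)) (i ℕ.+ j)
diag-via-ψ i j = sym (trans (at ψⁱφⁱ⁺ʲ (i ℕ.+ j)) (tₛ-pow-shift i j (psPow φ j)))
  where
  ψⁱφⁱ⁺ʲ : psPow ψ i ⊛ psPow φ (i ℕ.+ j) ≈ psPow tₛ i ⊛ psPow φ j
  ψⁱφⁱ⁺ʲ = begin
    psPow ψ i ⊛ psPow φ (i ℕ.+ j)          ≈⟨ ⊛-congˡ (psPow ψ i) (psPow-+ φ i j) ⟩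
    psPow ψ i ⊛ (psPow φ i ⊛ psPow φ j)    ≈⟨ regroup (psPow ψ i) (psPow φ i) (psPow φ j) ⟩
    (psPow φ i ⊛ psPow ψ i) ⊛ psPow φ j    ≈⟨ ⊛-congʳ (psPow φ j) (psPow-⊛ φ ψ i) ⟨
    psPow (φ ⊛ ψ) i ⊛ psPow φ j            ≈⟨ ⊛-congʳ (psPow φ j) (psPow-cong i φ-ψ) ⟩
    psPow tₛ i ⊛ psPow φ j                 ∎
    where
    open ≈-Reasoning
    regroup : ∀ a b c → a ⊛ (b ⊛ c) ≈ (b ⊛ a) ⊛ c
    regroup = solve 3 (λ a b c → a :* (b :* c) := (b :* a) :* c) ≈-refl

-- G · diag = 1: the n-th coefficient is [t^n] G(ψ) φ^n = [t^n] e^t φ^{n+1} = δ_{n0}.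
G-diag : G ⊛ diag ≈ 1ₛ
G-diag = coeffwise λ n → let open ≡-Reasoning in begin
  sumTo n (λ i → G i * diag (n ∸ i))
    ≡⟨ sumTo-cong n (λ i i≤n → cong (G i *_) (trans (diag-via-ψ i (n ∸ i))
                                 (cong (λ z → (psPow ψ i ⊛ psPow φ z) z) (ℕP.m+[n∸m]≡n i≤n)))) ⟩
  sumTo n (λ i → G i * (psPow ψ i ⊛ psPow φ n) n)
    ≡⟨ sym (compose-⊛ G (psPow φ n) n) ⟩
  (compose G ⊛ psPow φ n) n
    ≡⟨ at (G∘ψ-φⁿ n) n ⟩
  (expₛ ⊛ psPow φ (suc n)) n
    ≡⟨ exp-φ-pow-diagonal n ⟩
  1ₛ n ∎
  where
  G∘ψ-φⁿ : ∀ n → compose G ⊛ psPow φ n ≈ expₛ ⊛ psPow φ (suc n)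
  G∘ψ-φⁿ n = begin
    compose G ⊛ psPow φ n                ≈⟨ ⊛-congˡ (compose G) (≈-trans (⊛-congʳ (psPow φ n) E-φ) (⊛-identityˡ (psPow φ n))) ⟨
    compose G ⊛ ((E ⊛ φ) ⊛ psPow φ n)    ≈⟨ regroup (compose G) E φ (psPow φ n) ⟩
    (compose G ⊛ E) ⊛ (φ ⊛ psPow φ n)    ≈⟨ ⊛-congʳ (psPow φ (suc n)) G-compose-E ⟩
    expₛ ⊛ psPow φ (suc n)               ∎
    where
    open ≈-Reasoning
    regroup : ∀ c e f p → c ⊛ ((e ⊛ f) ⊛ p) ≈ (c ⊛ e) ⊛ (f ⊛ p)
    regroup = solve 4 (λ c e f p → c :* ((e :* f) :* p) := (c :* e) :* (f :* p)) ≈-refl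

diag≈T : diag ≈ T
diag≈T = psInv-unique G diag refl G-diag

S₁ : ℕ → ℕ → ℚ
S₁ m j = ℤtoℚ (stirling1 m j)

stirling1-above : ∀ m j → m < j → stirling1 m j ≡ ℤ.+ 0
stirling1-above zero    (suc j) _       = refl
stirling1-above (suc m) (suc j) (s≤s m<j) = begin
  stirling1 m j ℤ.- ℤ.+ m ℤ.* stirling1 m (suc j)
    ≡⟨ cong₂ (λ u v → u ℤ.- ℤ.+ m ℤ.* v) (stirling1-above m j m<j) (stirling1-above m (suc j) (ℕP.m<n⇒m<1+n m<j)) ⟩
  ℤ.+ 0 ℤ.- ℤ.+ m ℤ.* ℤ.+ 0
    ≡⟨ cong (λ z → ℤ.+ 0 ℤ.- z) (ℤP.*-zeroʳ (ℤ.+ m)) ⟩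
  ℤ.+ 0 ∎
  where open ≡-Reasoning

S₁-suc : ∀ m i → S₁ (suc m) (suc i) ≡ S₁ m i - ℕtoℚ m * S₁ m (suc i)
S₁-suc m i = trans (ℤtoℚ-− (stirling1 m i) _) (cong (λ z → S₁ m i - z) (ℤtoℚ-* (ℤ.+ m) (stirling1 m (suc i))))

m*S₁[m,0]≡0 : ∀ m → ℕtoℚ m * S₁ m 0 ≡ 0ℚ
m*S₁[m,0]≡0 zero    = refl
m*S₁[m,0]≡0 (suc m) = ℚP.*-zeroʳ (ℕtoℚ (suc m))

falling-stirling : ∀ x m → fallingQ x m ≡ sumTo m (λ j → S₁ m j * powQ x j)
falling-stirling x zero    = refl
falling-stirling x (suc m) = begin
  fallingQ x m * (x - ℕtoℚ m)
    ≡⟨ cong (_* (x - ℕtoℚ m)) (falling-stirling x m) ⟩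
  Σm * (x - ℕtoℚ m)
    ≡⟨ expand Σm x (ℕtoℚ m) ⟩
  x * Σm - ℕtoℚ m * Σm
    ≡⟨ cong₂ _-_ (sym (sumTo-*ˡ m x _)) m*Σm ⟩
  sumTo m (λ i → x * (S₁ m i * powQ x i)) - sumTo m (λ i → ℕtoℚ m * (S₁ m (suc i) * powQ x (suc i)))
    ≡⟨ sym (sumTo-− m _ _) ⟩
  sumTo m (λ i → x * (S₁ m i * powQ x i) - ℕtoℚ m * (S₁ m (suc i) * powQ x (suc i)))
    ≡⟨ sumTo-cong m (λ i _ → trans (collect x (S₁ m i) (powQ x i) (ℕtoℚ m) (S₁ m (suc i)))
                                   (cong (_* powQ x (suc i)) (sym (S₁-suc m i)))) ⟩
  sumTo m (λ i → S₁ (suc m) (suc i) * powQ x (suc i))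
    ≡⟨ sym (ℚP.+-identityˡ _) ⟩
  S₁ (suc m) 0 * powQ x 0 + sumTo m (λ i → S₁ (suc m) (suc i) * powQ x (suc i))
    ≡⟨ sym (sumTo-head m (λ j → S₁ (suc m) j * powQ x j)) ⟩
  sumTo (suc m) (λ j → S₁ (suc m) j * powQ x j) ∎
  where
  open ≡-Reasoning
  Σm = sumTo m (λ j → S₁ m j * powQ x j)
  expand : ∀ s x a → s * (x - a) ≡ x * s - a * s
  expand = solve-∀ ℚ-ring
  collect : ∀ x s p a u → x * (s * p) - a * (u * (x * p)) ≡ (s - a * u) * (x * p)
  collect = solve-∀ ℚ-ring
  m*Σm : ℕtoℚ m * Σm ≡ sumTo m (λ i → ℕtoℚ m * (S₁ m (suc i) * powQ x (suc i)))
  m*Σm = begin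
    ℕtoℚ m * Σm
      ≡⟨ cong (ℕtoℚ m *_) (sym (sumTo-drop-last m _ top-vanishes)) ⟩
    ℕtoℚ m * sumTo (suc m) (λ j → S₁ m j * powQ x j)
      ≡⟨ cong (ℕtoℚ m *_) (sumTo-head m _) ⟩
    ℕtoℚ m * (S₁ m 0 * 1ℚ + sumTo m (λ i → S₁ m (suc i) * powQ x (suc i)))
      ≡⟨ distribute (ℕtoℚ m) (S₁ m 0) _ ⟩
    ℕtoℚ m * S₁ m 0 + ℕtoℚ m * sumTo m (λ i → S₁ m (suc i) * powQ x (suc i))
      ≡⟨ cong₂ _+_ (m*S₁[m,0]≡0 m) (sym (sumTo-*ˡ m (ℕtoℚ m) _)) ⟩
    0ℚ + sumTo m (λ i → ℕtoℚ m * (S₁ m (suc i) * powQ x (suc i)))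
      ≡⟨ ℚP.+-identityˡ _ ⟩
    sumTo m (λ i → ℕtoℚ m * (S₁ m (suc i) * powQ x (suc i))) ∎
    where
    top-vanishes : S₁ m (suc m) * powQ x (suc m) ≡ 0ℚ
    top-vanishes = trans (cong (λ z → ℤtoℚ z * powQ x (suc m)) (stirling1-above m (suc m) (ℕP.n<1+n m)))
                         (ℚP.*-zeroˡ (powQ x (suc m)))
    distribute : ∀ a s t → a * (s * 1ℚ + t) ≡ a * s + a * t
    distribute = solve-∀ ℚ-ring

sumComp-cong : ∀ r a {F G : Vec ℕ r → ℚ} → (∀ v → F v ≡ G v) → sumComp r a F ≡ sumComp r a G
sumComp-cong zero    zero    eq = eq []
sumComp-cong zero    (suc a) eq = refl
sumComp-cong (suc r) a       eq = sumTo-cong a (λ b _ → sumComp-cong r (a ∸ b) (λ v → eq (b ∷ v)))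

sumComp-*ˡ : ∀ r a c (F : Vec ℕ r → ℚ) → sumComp r a (λ v → c * F v) ≡ c * sumComp r a F
sumComp-*ˡ zero    zero    c F = refl
sumComp-*ˡ zero    (suc a) c F = sym (ℚP.*-zeroʳ c)
sumComp-*ˡ (suc r) a       c F =
  trans (sumTo-cong a (λ b _ → sumComp-*ˡ r (a ∸ b) c (λ v → F (b ∷ v))))
        (sumTo-*ˡ a c (λ b → sumComp r (a ∸ b) (λ v → F (b ∷ v))))

sumComp-power : ∀ f r a → sumComp r a (vprodQ f) ≡ psPow f r a
sumComp-power f zero    zero    = refl
sumComp-power f zero    (suc a) = refl
sumComp-power f (suc r) a       = sumTo-cong a (λ b _ →
  trans (sumComp-*ˡ r (a ∸ b) (f b) (vprodQ f)) (cong (f b *_) (sumComp-power f r (a ∸ b))))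

vprodQ-* : ∀ {r} f g (as : Vec ℕ r) → vprodQ f as * vprodQ g as ≡ vprodQ (λ b → f b * g b) as
vprodQ-* f g []       = refl
vprodQ-* f g (a ∷ as) =
  trans (interchange (f a) (vprodQ f as) (g a) (vprodQ g as)) (cong (f a * g a *_) (vprodQ-* f g as))
  where
  interchange : ∀ a b c d → (a * b) * (c * d) ≡ (a * c) * (b * d)
  interchange = solve-∀ ℚ-ring

vprodQ-cong : ∀ {r} {f g} (as : Vec ℕ r) → (∀ b → f b ≡ g b) → vprodQ f as ≡ vprodQ g as
vprodQ-cong []       eq = refl
vprodQ-cong (a ∷ as) eq = cong₂ _*_ (eq a) (vprodQ-cong as eq)

-- Since B_b^{(b)} = b! [t^b] φ^b = b! [t^b] T, the multinomial weights turn
-- products of Bernoulli numbers into coefficients of T^r: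
-- Σ_{a₁+⋯+a_r = a} (a; a₁,…,a_r) Π B_{a_i}^{(a_i)} = a! [t^a] T^r.
bernoulli-compositions : ∀ r a →
  sumComp r a (λ as → multinomial a as * vprodQ (λ b → bernoulliOrd b b) as) ≡ ℕtoℚ (a !) * psPow T r a
bernoulli-compositions r a = begin
  sumComp r a (λ as → multinomial a as * vprodQ (λ b → bernoulliOrd b b) as)
    ≡⟨ sumComp-cong r a (λ as → trans (ℚP.*-assoc (ℕtoℚ (a !)) _ _)
         (cong (ℕtoℚ (a !) *_) (trans (vprodQ-* _ _ as) (vprodQ-cong as diag-weight)))) ⟩
  sumComp r a (λ as → ℕtoℚ (a !) * vprodQ diag as)
    ≡⟨ sumComp-*ˡ r a (ℕtoℚ (a !)) (vprodQ diag) ⟩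
  ℕtoℚ (a !) * sumComp r a (vprodQ diag)
    ≡⟨ cong (ℕtoℚ (a !) *_) (trans (sumComp-power diag r a) (at (psPow-cong r diag≈T) a)) ⟩
  ℕtoℚ (a !) * psPow T r a ∎
  where
  open ≡-Reasoning
  diag-weight : ∀ b → recip (b !) * bernoulliOrd b b ≡ diag b
  diag-weight b = trans (sym (ℚP.*-assoc (recip (b !)) (ℕtoℚ (b !)) (diag b)))
    (trans (cong (_* diag b) (recip-factorial b)) (ℚP.*-identityˡ (diag b)))

egf-convolution : ∀ P R m →
  sumTo m (λ a → binomQ m a * (ℕtoℚ (a !) * P a) * (ℕtoℚ ((m ∸ a) !) * R (m ∸ a))) ≡ ℕtoℚ (m !) * (P ⊛ R) m
egf-convolution P R m = trans
  (sumTo-cong m (λ a a≤m → trans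
    (regroup (binomQ m a) (ℕtoℚ (a !)) (P a) (ℕtoℚ ((m ∸ a) !)) (R (m ∸ a)))
    (cong (_* (P a * R (m ∸ a))) (binomQ-factorials a≤m))))
  (sumTo-*ˡ m (ℕtoℚ (m !)) _)
  where
  regroup : ∀ c f p g q → c * (f * p) * (g * q) ≡ c * (f * g) * (p * q)
  regroup = solve-∀ ℚ-ring

-- Proof of Corollary 4

Q : ℕ → ℤ → PS
Q r k = psPow T r ⊛ lifNegLog k

-- The innermost double sum of the formula: summing over a and the
-- compositions of a gives m! [t^m] T^r Lif_k(-log(1+t)), as C̃_i^{(k)} = i! [t^i] Lif_k(-log(1+t)).
composition-sum : ∀ r k m →
  sumTo m (λ a → sumComp r a λ as →
    binomQ m a * multinomial a as * vprodQ (λ b → bernoulliOrd b b) as * Ctilde k (m ∸ a))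
  ≡ ℕtoℚ (m !) * Q r k m
composition-sum r k m = begin
  sumTo m (λ a → sumComp r a λ as → binomQ m a * multinomial a as * vprodQ Bern as * Ctilde k (m ∸ a))
    ≡⟨ sumTo-cong m (λ a _ → trans
         (sumComp-cong r a (λ as → pull-out (binomQ m a) (multinomial a as) (vprodQ Bern as) (Ctilde k (m ∸ a))))
         (sumComp-*ˡ r a (binomQ m a * Ctilde k (m ∸ a)) (λ as → multinomial a as * vprodQ Bern as))) ⟩
  sumTo m (λ a → binomQ m a * Ctilde k (m ∸ a) * sumComp r a (λ as → multinomial a as * vprodQ Bern as))
    ≡⟨ sumTo-cong m (λ a _ → trans (cong (binomQ m a * Ctilde k (m ∸ a) *_) (bernoulli-compositions r a))
         (regroup (binomQ m a) (ℕtoℚ ((m ∸ a) !)) (lifNegLog k (m ∸ a)) (ℕtoℚ (a !)) (psPow T r a))) ⟩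
  sumTo m (λ a → binomQ m a * (ℕtoℚ (a !) * psPow T r a) * (ℕtoℚ ((m ∸ a) !) * lifNegLog k (m ∸ a)))
    ≡⟨ egf-convolution (psPow T r) (lifNegLog k) m ⟩
  ℕtoℚ (m !) * Q r k m ∎
  where
  open ≡-Reasoning
  Bern : ℕ → ℚ
  Bern b = bernoulliOrd b b
  pull-out : ∀ c u v w → c * u * v * w ≡ c * w * (u * v)
  pull-out = solve-∀ ℚ-ring
  regroup : ∀ c f λ′ g p → c * (f * λ′) * (g * p) ≡ c * (g * p) * (f * λ′)
  regroup = solve-∀ ℚ-ring

coeffRHS-closed : ∀ r k n j → j ≤ n → coeffRHS r k n j ≡
  sumTo (n ∸ j) (λ l → ℕtoℚ (n !) * recip ((l ℕ.+ j) !) * S₁ (l ℕ.+ j) j * Q r k (n ∸ (l ℕ.+ j)))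
coeffRHS-closed r k n j j≤n = sumTo-cong (n ∸ j) term
  where
  open ≡-Reasoning
  term : ∀ l → l ≤ n ∸ j →
    sumTo (n ∸ j ∸ l) (λ a → sumComp r a λ as →
      binomQ n (l ℕ.+ j) * binomQ (n ∸ j ∸ l) a * multinomial a as * ℤtoℚ (stirling1 (l ℕ.+ j) j)
      * vprodQ (λ b → bernoulliOrd b b) as * Ctilde k (n ∸ j ∸ l ∸ a))
    ≡ ℕtoℚ (n !) * recip ((l ℕ.+ j) !) * S₁ (l ℕ.+ j) j * Q r k (n ∸ (l ℕ.+ j))
  term l l≤ = begin
    sumTo m (λ a → sumComp r a λ as → B * binomQ m a * multinomial a as * S * vprodQ Bern as * Ctilde k (m ∸ a))
      ≡⟨ sumTo-cong m (λ a _ → trans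
           (sumComp-cong r a (λ as → pull-out B S (binomQ m a) (multinomial a as) (vprodQ Bern as) (Ctilde k (m ∸ a))))
           (sumComp-*ˡ r a (B * S) (λ as → binomQ m a * multinomial a as * vprodQ Bern as * Ctilde k (m ∸ a)))) ⟩
    sumTo m (λ a → B * S * sumComp r a λ as → binomQ m a * multinomial a as * vprodQ Bern as * Ctilde k (m ∸ a))
      ≡⟨ sumTo-*ˡ m (B * S) (λ a → sumComp r a λ as → binomQ m a * multinomial a as * vprodQ Bern as * Ctilde k (m ∸ a)) ⟩
    B * S * sumTo m (λ a → sumComp r a λ as → binomQ m a * multinomial a as * vprodQ Bern as * Ctilde k (m ∸ a))
      ≡⟨ cong (B * S *_) (composition-sum r k m) ⟩
    B * S * (ℕtoℚ (m !) * Q r k m)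
      ≡⟨ cong (λ z → B * S * (ℕtoℚ (z !) * Q r k z)) m≡n∸[l+j] ⟩
    B * S * (ℕtoℚ ((n ∸ (l ℕ.+ j)) !) * Q r k (n ∸ (l ℕ.+ j)))
      ≡⟨ regroup B S (ℕtoℚ ((n ∸ (l ℕ.+ j)) !)) (Q r k (n ∸ (l ℕ.+ j))) ⟩
    B * ℕtoℚ ((n ∸ (l ℕ.+ j)) !) * S * Q r k (n ∸ (l ℕ.+ j))
      ≡⟨ cong (λ z → z * S * Q r k (n ∸ (l ℕ.+ j))) (binomQ-factorial l+j≤n) ⟩
    ℕtoℚ (n !) * recip ((l ℕ.+ j) !) * S * Q r k (n ∸ (l ℕ.+ j)) ∎
    where
    m = n ∸ j ∸ l
    B = binomQ n (l ℕ.+ j)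
    S = S₁ (l ℕ.+ j) j
    Bern : ℕ → ℚ
    Bern b = bernoulliOrd b b
    pull-out : ∀ b s c u v w → b * c * u * s * v * w ≡ b * s * (c * u * v * w)
    pull-out = solve-∀ ℚ-ring
    regroup : ∀ b s f q → b * s * (f * q) ≡ b * f * s * q
    regroup = solve-∀ ℚ-ring
    m≡n∸[l+j] : m ≡ n ∸ (l ℕ.+ j)
    m≡n∸[l+j] = trans (ℕP.∸-+-assoc n j l) (cong (n ∸_) (ℕP.+-comm j l))
    l+j≤n : l ℕ.+ j ≤ n
    l+j≤n = ℕP.≤-trans (ℕP.+-monoˡ-≤ j l≤) (ℕP.≤-reflexive (ℕP.m∸n+n≡m j≤n))

Atilde-expansion : ∀ r k n x →
  Atilde r k n x ≡ sumTo n (λ m → ℕtoℚ (n !) * recip (m !) * Q r k (n ∸ m) * fallingQ x m)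
Atilde-expansion r k n x = begin
  ℕtoℚ (n !) * (Q r k ⊛ onePlusPow x) n
    ≡⟨ cong (ℕtoℚ (n !) *_) (at (⊛-comm (Q r k) (onePlusPow x)) n) ⟩
  ℕtoℚ (n !) * sumTo n (λ m → fallingQ x m * recip (m !) * Q r k (n ∸ m))
    ≡⟨ sym (sumTo-*ˡ n (ℕtoℚ (n !)) _) ⟩
  sumTo n (λ m → ℕtoℚ (n !) * (fallingQ x m * recip (m !) * Q r k (n ∸ m)))
    ≡⟨ sumTo-cong n (λ m _ → reorder (ℕtoℚ (n !)) (fallingQ x m) (recip (m !)) (Q r k (n ∸ m))) ⟩
  sumTo n (λ m → ℕtoℚ (n !) * recip (m !) * Q r k (n ∸ m) * fallingQ x m) ∎
  where
  open ≡-Reasoning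
  reorder : ∀ c f r q → c * (f * r * q) ≡ c * r * q * f
  reorder = solve-∀ ℚ-ring

-- Collecting the right-hand side by the total index m = l + j turns
-- Σ_j x^j Σ_l into Σ_m n!/m! [t^{n-m}] T^r Lif_k(-log(1+t)) Σ_{j ≤ m} S₁(m, j) x^j.
rhs-reindexed : ∀ r k n x → rhs r k n x ≡
  sumTo n (λ m → ℕtoℚ (n !) * recip (m !) * Q r k (n ∸ m) * sumTo m (λ j → S₁ m j * powQ x j))
rhs-reindexed r k n x = begin
  sumTo n (λ j → coeffRHS r k n j * powQ x j)
    ≡⟨ sumTo-cong n (λ j j≤n → trans (cong (_* powQ x j) (coeffRHS-closed r k n j j≤n))
                                     (sym (sumTo-*ʳ (n ∸ j) (powQ x j) _))) ⟩
  sumTo n (λ j → sumTo (n ∸ j) (λ l → W j (l ℕ.+ j)))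
    ≡⟨ sumTo-triangle n (λ j l → W j (l ℕ.+ j)) ⟩
  sumTo n (λ m → sumTo m (λ j → W j (m ∸ j ℕ.+ j)))
    ≡⟨ sumTo-cong n (λ m _ → trans
         (sumTo-cong m (λ j j≤m → trans (cong (W j) (ℕP.m∸n+n≡m j≤m))
                                        (regroup (ℕtoℚ (n !)) (recip (m !)) (S₁ m j) (Q r k (n ∸ m)) (powQ x j))))
         (sumTo-*ˡ m (ℕtoℚ (n !) * recip (m !) * Q r k (n ∸ m)) (λ j → S₁ m j * powQ x j))) ⟩
  sumTo n (λ m → ℕtoℚ (n !) * recip (m !) * Q r k (n ∸ m) * sumTo m (λ j → S₁ m j * powQ x j)) ∎
  where
  open ≡-Reasoning
  W : ℕ → ℕ → ℚ
  W j s = ℕtoℚ (n !) * recip (s !) * S₁ s j * Q r k (n ∸ s) * powQ x j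
  regroup : ∀ a b c d e → a * b * c * d * e ≡ a * b * d * (c * e)
  regroup = solve-∀ ℚ-ring

-- Corollary 4: expand Ã_n^{(r,k)}(x), replace the falling factorials by Stirling
-- sums, and recognise the reindexed right-hand side.
corollary4 : (r : ℕ) → r ≥ 1 → (k : ℤ) → (n : ℕ) → (x : ℚ) →
    Atilde r k n x ≡ rhs r k n x
corollary4 r _ k n x = begin
  Atilde r k n x
    ≡⟨ Atilde-expansion r k n x ⟩
  sumTo n (λ m → ℕtoℚ (n !) * recip (m !) * Q r k (n ∸ m) * fallingQ x m)
    ≡⟨ sumTo-cong n (λ m _ → cong (ℕtoℚ (n !) * recip (m !) * Q r k (n ∸ m) *_) (falling-stirling x m)) ⟩
  sumTo n (λ m → ℕtoℚ (n !) * recip (m !) * Q r k (n ∸ m) * sumTo m (λ j → S₁ m j * powQ x j))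
    ≡⟨ rhs-reindexed r k n x ⟨
  rhs r k n x ∎
  where open ≡-Reasoning
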